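{- Let $D$ be a normalized correct calculation DAG of a semigroup evaluation, and let $r$ be an (intermediate) result in $D$ with $r=\prod_{j=c}^d a_j$, where $c+1\leq d$. Then for every $i\in[c,d-1]$ there is a vertex $v_t$ which applies the semigroup operation to intermediate results such that its value is $x=\prod_{j=h}^{i}a_j\cdot\prod_{m=i+1}^{k}a_m$ with $1\leq c\leq h\leq i\leq k-1\leq d-1\leq N-1$.
   Context: A program for computing $\prod_{i=1}^N a_i$ in a semigroup is a straight-line sequence of applications $z=x\cdot y$ of the (associative) semigroup operation to input values $a_1,\dots,a_N$ or previously computed intermediate results. Its calculation DAG has one vertex for each input value, each intermediate result and the output variable; for each application $z=x\cdot y$ with operands represented by $v_x,v_y$ and result by $v_z$ there are directed edges $(v_x,v_z)$ and $(v_y,v_z)$. A variable $x$ is used for $y$ if there is a directed path from $v_x$ to $v_y$. The DAG is normalized if every vertex is used for the output vertex, and correct if, for every semigroup and every input values, the output variable equals $\prod_{i=1}^N a_i$. Products are understood formally (in the free semigroup on $a_1,\dots,a_N$); the displayed form of $x$ means that $v_t$ applies the operation to an operand representing $\prod_{j=h}^i a_j$ and an operand representing $\prod_{m=i+1}^k a_m$. -}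

module Defs where

open import Data.Nat using (ℕ; zero; suc; _+_; _∸_)
open import Data.Fin using (Fin; zero; suc; toℕ; fromℕ; inject₁)
open import Data.List using (List; [_]; _++_; map; upTo)
open import Data.Maybe using (Maybe; just; nothing)
import Data.Maybe as Maybe
open import Data.Product using (∃₂; _×_)
open import Data.Sum using (_⊎_)
open import Relation.Binary.PropositionalEquality using (_≡_)
open import Relation.Binary.Construct.Closure.ReflexiveTransitive using (Star)

-- Straight-line programs over N inputs, as calculation DAGs.
-- Vertices 0 .. N-1 are the inputs a_1 .. a_N (vertex j holds a_{j+1});
-- each instruction appends a new vertex (index m) computing  x · y
-- from two earlier vertices x, y.
data Prog (N : ℕ) : ℕ → Set where
  []  : Prog N N
  _▷_ : ∀ {m} → Prog N m → Fin m × Fin m → Prog N (suc m)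

open import Data.Product using (_,_) public

-- split v = nothing  if v is the last element of Fin (suc n),
--         = just w   if v = inject₁ w.
split : ∀ {n} → Fin (suc n) → Maybe (Fin n)
split {zero}  zero    = nothing
split {suc n} zero    = just zero
split {suc n} (suc v) = Maybe.map suc (split v)

-- Formal value of a vertex in the free semigroup on a_1,...,a_N,
-- represented as the (nonempty) list of indices of the word.
val : ∀ {N m} → Prog N m → Fin m → List ℕ
val [] v = [ suc (toℕ v) ]
val (p ▷ (x , y)) v with split v
... | just w  = val p w
... | nothing = val p x ++ val p y

-- seg c d = [c, c+1, ..., d]  i.e. the word  ∏_{j=c}^{d} a_j  (for c ≤ d).
seg : ℕ → ℕ → List ℕ
seg c d = map (_+ c) (upTo (suc d ∸ c))

data Op {N : ℕ} : ∀ {m} → Prog N m → Fin m → Fin m → Fin m → Set where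
  here  : ∀ {m} {p : Prog N m} {x y : Fin m} →
          Op (p ▷ (x , y)) (fromℕ m) (inject₁ x) (inject₁ y)
  there : ∀ {m} {p : Prog N m} {o : Fin m × Fin m} {t x y : Fin m} →
          Op p t x y → Op (p ▷ o) (inject₁ t) (inject₁ x) (inject₁ y)

Edge : ∀ {N m} → Prog N m → Fin m → Fin m → Set
Edge p u w = ∃₂ λ x y → Op p w x y × (u ≡ x ⊎ u ≡ y)

UsedFor : ∀ {N m} → Prog N m → Fin m → Fin m → Set
UsedFor p = Star (Edge p)

output : ∀ {N m} → Prog N (suc m) → Fin (suc m)
output {m = m} _ = fromℕ m

Normalized : ∀ {N m} → Prog N (suc m) → Set
Normalized p = ∀ v → UsedFor p v (output p)

Correct : ∀ {N m} → Prog N (suc m) → Set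
Correct {N} p = val p (output p) ≡ seg 1 N

module Submission where

-- If a vertex r has formal value  L ++ R  with L and R nonempty, then
-- some operation vertex  x · y  of the program has  val x  a suffix of L and
-- val y  a prefix of R.  Proof by induction on the program: an input has a
-- one-letter value and cannot be cut; an operation vertex r = x · y has value
-- val x ++ val y, and comparing this factorisation with L ++ R either finds
-- the cut exactly at r, or places it strictly inside val x or inside val y,
-- where the induction hypothesis applies.  This holds for arbitrary words.
--
-- Lemma 10 then
-- cuts  seg c d = seg c i ++ seg (i+1) d.

open import Defs
open import Data.Nat using (ℕ; zero; suc; _+_; _∸_; _≤_; _<_; z≤n; s≤s)
open import Data.Nat.Properties
open import Data.Fin using (Fin; fromℕ; inject₁)
import Data.Fin as Fin
open import Data.Fin.Properties using (toℕ<n)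
open import Data.Product using (Σ; ∃; ∃₂; _×_; _,_; proj₁; proj₂)
open import Data.Sum using (_⊎_; inj₁; inj₂)
import Data.Sum as Sum
open import Data.List using (List; []; _∷_; [_]; _++_; map; upTo; applyUpTo)
open import Data.List.Properties using (∷-injective; ++-identityʳ; ++-assoc; ++-conicalˡ; ++-conicalʳ; ∷-injectiveʳ; map-upTo; map-∘; map-cong)
open import Data.List.Membership.Propositional using (_∈_)
open import Data.List.Membership.Propositional.Properties using (∈-++⁻; ∈-map⁺; ∈-upTo⁺)
open import Data.List.Relation.Unary.Any using (here)
open import Data.Maybe using (just; nothing)
open import Data.Empty using (⊥; ⊥-elim)
open import Relation.Nullary using (yes; no)
open import Relation.Binary.PropositionalEquality using (_≡_; _≢_; refl; sym; trans; cong; cong₂; subst; module ≡-Reasoning)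
open ≡-Reasoning

++-trichotomy : ∀ {A : Set} (xs ys us vs : List A) → xs ++ ys ≡ us ++ vs →
  (xs ≡ us × ys ≡ vs)
  ⊎ (∃₂ λ w ws → us ≡ xs ++ w ∷ ws × ys ≡ (w ∷ ws) ++ vs)
  ⊎ (∃₂ λ w ws → xs ≡ us ++ w ∷ ws × vs ≡ (w ∷ ws) ++ ys)
++-trichotomy []       ys []       vs eq = inj₁ (refl , eq)
++-trichotomy []       ys (u ∷ us) vs eq = inj₂ (inj₁ (u , us , refl , eq))
++-trichotomy (x ∷ xs) ys []       vs eq = inj₂ (inj₂ (x , xs , refl , sym eq))
++-trichotomy (x ∷ xs) ys (u ∷ us) vs eq with ∷-injective eq
... | refl , eq′ =
  Sum.map (λ (e₁ , e₂) → cong (x ∷_) e₁ , e₂)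
          (Sum.map (λ (w , ws , e₁ , e₂) → w , ws , cong (x ∷_) e₁ , e₂)
                   (λ (w , ws , e₁ , e₂) → w , ws , cong (x ∷_) e₁ , e₂))
          (++-trichotomy xs ys us vs eq′)

∷≢[] : ∀ {A : Set} {x : A} {xs : List A} → x ∷ xs ≢ []
∷≢[] ()

singleton-uncuttable : ∀ {A : Set} {a : A} (L R : List A) →
  [ a ] ≡ L ++ R → L ≢ [] → R ≢ [] → ⊥
singleton-uncuttable []      R eq L≢[] _    = L≢[] refl
singleton-uncuttable (l ∷ L) R eq _    R≢[] = R≢[] (++-conicalʳ L R (sym (∷-injectiveʳ eq)))

split-inject₁ : ∀ {n} (v : Fin n) → split (inject₁ v) ≡ just v
split-inject₁ {suc n} Fin.zero    = refl
split-inject₁ {suc n} (Fin.suc v) rewrite split-inject₁ v = refl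

val-inject₁ : ∀ {N m} (p : Prog N m) (x y v : Fin m) →
  val (p ▷ (x , y)) (inject₁ v) ≡ val p v
val-inject₁ p x y v rewrite split-inject₁ v = refl

val-nonempty : ∀ {N m} (p : Prog N m) (v : Fin m) → val p v ≢ []
val-nonempty []            v ()
val-nonempty (p ▷ (x , y)) v with split v
... | just w  = val-nonempty p w
... | nothing = λ e → val-nonempty p x (++-conicalˡ (val p x) (val p y) e)

val-letters : ∀ {N m} (p : Prog N m) (v : Fin m) {e : ℕ} →
  e ∈ val p v → 1 ≤ e × e ≤ N
val-letters []            v (here refl) = s≤s z≤n , toℕ<n v
val-letters (p ▷ (x , y)) v e∈ with split v
... | just w  = val-letters p w e∈
... | nothing = Sum.[ val-letters p x , val-letters p y ] (∈-++⁻ (val p x) e∈)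

record Cut {N m : ℕ} (p : Prog N m) (L R : List ℕ) : Set where
  constructor cut
  field
    t x y  : Fin m
    op     : Op p t x y
    suffix : ∃ λ L₁ → L ≡ L₁ ++ val p x
    prefix : ∃ λ R₂ → R ≡ val p y ++ R₂

cut-weaken : ∀ {N m} {p : Prog N m} {x y : Fin m} {L R : List ℕ} →
  Cut p L R → Cut (p ▷ (x , y)) L R
cut-weaken {p = p} {x} {y} (cut t u w op (L₁ , eL) (R₂ , eR)) =
  cut (inject₁ t) (inject₁ u) (inject₁ w) (there op)
      (L₁ , trans eL (cong (L₁ ++_) (sym (val-inject₁ p x y u))))
      (R₂ , trans eR (cong (_++ R₂) (sym (val-inject₁ p x y w))))

cut-widenˡ : ∀ {N m} {p : Prog N m} {L M R : List ℕ} (A : List ℕ) →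
  L ≡ A ++ M → Cut p M R → Cut p L R
cut-widenˡ {p = p} A eL (cut t x y op (M₁ , eM) pre) =
  cut t x y op (A ++ M₁ , trans eL (trans (cong (A ++_) eM) (sym (++-assoc A M₁ (val p x))))) pre

cut-widenʳ : ∀ {N m} {p : Prog N m} {L M R : List ℕ} (B : List ℕ) →
  R ≡ M ++ B → Cut p L M → Cut p L R
cut-widenʳ {p = p} B eR (cut t x y op suf (M₂ , eM)) =
  cut t x y op suf (M₂ ++ B , trans eR (trans (cong (_++ B) eM) (++-assoc (val p y) M₂ B)))

cut-realised : ∀ {N m} (p : Prog N m) (r : Fin m) {L R : List ℕ} →
  val p r ≡ L ++ R → L ≢ [] → R ≢ [] → Cut p L R
cut-realised []            r {L} {R} eq L≢[] R≢[] = ⊥-elim (singleton-uncuttable L R eq L≢[] R≢[])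
cut-realised (p ▷ (x , y)) r {L} {R} eq L≢[] R≢[] with split r
... | just w  = cut-weaken (cut-realised p w eq L≢[] R≢[])
... | nothing with ++-trichotomy (val p x) (val p y) L R eq
...   | inj₁ (refl , refl) =
  cut (fromℕ _) (inject₁ x) (inject₁ y) here
      ([] , sym (val-inject₁ p x y x))
      ([] , sym (trans (++-identityʳ _) (val-inject₁ p x y y)))
...   | inj₂ (inj₁ (w , ws , refl , ey)) =
  cut-weaken (cut-widenˡ (val p x) refl (cut-realised p y ey (λ ()) R≢[]))
...   | inj₂ (inj₂ (w , ws , ex , refl)) =
  cut-weaken (cut-widenʳ (val p y) refl (cut-realised p x ex L≢[] (λ ())))

seg-empty : ∀ {c d} → d < c → seg c d ≡ []
seg-empty {c} d<c = cong (λ n → map (_+ c) (upTo n)) (m≤n⇒m∸n≡0 d<c)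

seg-cons : ∀ {c d} → c ≤ d → seg c d ≡ c ∷ seg (suc c) d
seg-cons {c} {d} c≤d = begin
  map (_+ c) (upTo (suc d ∸ c))            ≡⟨ cong (λ n → map (_+ c) (upTo n)) (+-∸-assoc 1 c≤d) ⟩
  c ∷ map (_+ c) (applyUpTo suc (d ∸ c))    ≡⟨ cong (λ js → c ∷ map (_+ c) js) (sym (map-upTo suc (d ∸ c))) ⟩
  c ∷ map (_+ c) (map suc (upTo (d ∸ c)))   ≡⟨ cong (c ∷_) (sym (map-∘ (upTo (d ∸ c)))) ⟩
  c ∷ map (λ j → suc j + c) (upTo (d ∸ c))  ≡⟨ cong (c ∷_) (map-cong (λ j → sym (+-suc j c)) (upTo (d ∸ c))) ⟩
  c ∷ seg (suc c) d                         ∎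

seg-nonempty : ∀ {c d} → c ≤ d → seg c d ≢ []
seg-nonempty c≤d e = ∷≢[] (trans (sym (seg-cons c≤d)) e)

seg-start≤end : ∀ {c d} → seg c d ≢ [] → c ≤ d
seg-start≤end {c} {d} ne with c ≤? d
... | yes c≤d = c≤d
... | no  c≰d = ⊥-elim (ne (seg-empty (≰⇒> c≰d)))

seg-uncons : ∀ {c d x} {xs : List ℕ} → seg c d ≡ x ∷ xs →
  c ≡ x × seg (suc c) d ≡ xs × c ≤ d
seg-uncons eq with c≤d ← seg-start≤end (λ e → ∷≢[] (trans (sym eq) e))
  with refl , eq′ ← ∷-injective (trans (sym (seg-cons c≤d)) eq) = refl , eq′ , c≤d

seg-singleton : ∀ c → seg c c ≡ [ c ]
seg-singleton c = trans (seg-cons ≤-refl) (cong (c ∷_) (seg-empty (n<1+n c)))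

∈-seg : ∀ {c e d} → c ≤ e → e ≤ d → e ∈ seg c d
∈-seg {c} {e} {d} c≤e e≤d =
  subst (_∈ seg c d) (m∸n+n≡m c≤e) (∈-map⁺ (_+ c) (∈-upTo⁺ (∸-monoˡ-< (s≤s e≤d) c≤e)))

seg-++ : ∀ {c i d} → c ≤ suc i → i ≤ d → seg c d ≡ seg c i ++ seg (suc i) d
seg-++ {c} {i} {d} c≤1+i i≤d = from-gap (suc i ∸ c) c (m∸n+n≡m c≤1+i)
  where
  from-gap : ∀ g s → g + s ≡ suc i → seg s d ≡ seg s i ++ seg (suc i) d
  from-gap zero    s refl = cong (_++ seg (suc i) d) (sym (seg-empty (n<1+n i)))
  from-gap (suc g) s e = begin
    seg s d                               ≡⟨ seg-cons (≤-trans s≤i i≤d) ⟩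
    s ∷ seg (suc s) d                     ≡⟨ cong (s ∷_) (from-gap g (suc s) (trans (+-suc g s) e)) ⟩
    s ∷ (seg (suc s) i ++ seg (suc i) d)  ≡⟨ cong (_++ seg (suc i) d) (sym (seg-cons s≤i)) ⟩
    seg s i ++ seg (suc i) d              ∎
    where
    s≤i : s ≤ i
    s≤i = subst (s ≤_) (suc-injective e) (m≤n+m s g)

seg-suffix : ∀ {c i} (L S : List ℕ) → seg c i ≡ L ++ S → S ≢ [] →
  Σ ℕ λ h → S ≡ seg h i × c ≤ h × h ≤ i
seg-suffix {c} []      S eq S≢[] = c , sym eq , ≤-refl , seg-start≤end (λ e → S≢[] (trans (sym eq) e))
seg-suffix     (_ ∷ L) S eq S≢[] =
  let _ , eq′ , _ = seg-uncons eq
      h , eS , 1+c≤h , h≤i = seg-suffix L S eq′ S≢[]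
  in  h , eS , <⇒≤ 1+c≤h , h≤i

seg-prefix : ∀ {c d} (P R : List ℕ) → seg c d ≡ P ++ R → P ≢ [] →
  Σ ℕ λ k → P ≡ seg c k × c ≤ k × k ≤ d
seg-prefix []          R eq P≢[] = ⊥-elim (P≢[] refl)
seg-prefix {c} (p ∷ []) R eq _ =
  let c≡p , _ , c≤d = seg-uncons eq
  in  c , trans (cong [_] (sym c≡p)) (sym (seg-singleton c)) , ≤-refl , c≤d
seg-prefix {c} (p ∷ q ∷ P) R eq _ =
  let c≡p , eq′ , _ = seg-uncons eq
      k , eP , 1+c≤k , k≤d = seg-prefix (q ∷ P) R eq′ ∷≢[]
  in  k , trans (cong₂ _∷_ (sym c≡p) eP) (sym (seg-cons (<⇒≤ 1+c≤k))) , <⇒≤ 1+c≤k , k≤d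

seg-endpoints : ∀ {N m} (p : Prog N m) (r : Fin m) {c d} →
  val p r ≡ seg c d → c ≤ d → 1 ≤ c × d ≤ N
seg-endpoints {N} p r {c} {d} eq c≤d = proj₁ (letter (∈-seg ≤-refl c≤d)) , proj₂ (letter (∈-seg c≤d ≤-refl))
  where
  letter : ∀ {e} → e ∈ seg c d → 1 ≤ e × e ≤ N
  letter e∈ = val-letters p r (subst (_ ∈_) (sym eq) e∈)

-- Cut  val D r = seg c d  between i and i + 1.  The realising vertex  x · y
-- has  val x  a nonempty suffix of  seg c i  and  val y  a nonempty prefix of
-- seg (i+1) d, i.e. the segments  seg h i  and  seg (i+1) k; the bounds on
-- c and d come from the letters of val D r being input indices.
lemma10 : ∀ (N m : ℕ) (D : Prog N (suc m)) → Normalized D → Correct D →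
          ∀ (r : Fin (suc m)) (c d : ℕ) → val D r ≡ seg c d → suc c ≤ d →
          ∀ (i : ℕ) → c ≤ i → i < d →
          Σ (Fin (suc m)) λ t → Σ (Fin (suc m)) λ x → Σ (Fin (suc m)) λ y →
          Σ ℕ λ h → Σ ℕ λ k →
            Op D t x y × val D x ≡ seg h i × val D y ≡ seg (suc i) k ×
            1 ≤ c × c ≤ h × h ≤ i × suc i ≤ k × k ≤ d × d ≤ N
lemma10 N m D _ _ r c d eq _ i c≤i i<d =
  let cut t x y op (L₁ , eL) (R₂ , eR) =
        cut-realised D r (trans eq (seg-++ (m≤n⇒m≤1+n c≤i) (<⇒≤ i<d)))
                     (seg-nonempty c≤i) (seg-nonempty i<d)
      h , ex , c≤h , h≤i = seg-suffix L₁ (val D x) eL (val-nonempty D x)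
      k , ey , i<k , k≤d = seg-prefix (val D y) R₂ eR (val-nonempty D y)
      1≤c , d≤N = seg-endpoints D r eq (≤-trans c≤i (<⇒≤ i<d))
  in  t , x , y , h , k , op , ex , ey , 1≤c , c≤h , h≤i , i<k , k≤d , d≤N
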